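{- Let $d$ be a degree sequence with canonical decomposition \[d=\alpha_1\circ\cdots\circ\alpha_k\circ d_0 .\] Then \[\mathscr{G}(d)\cong \mathscr{G}(\alpha_1)\,\Box\,\cdots\,\Box\,\mathscr{G}(\alpha_k)\,\Box\,\mathscr{G}(d_0),\] where $\Box$ denotes the Cartesian product of graphs.
   Context: All graphs are finite and simple; degree sequences are written in descending order. For a degree sequence $d=(d_1,\dots,d_n)$, a realization of $d$ is a graph with vertex set $\{1,\dots,n\}$ in which vertex $i$ has degree $d_i$ (realizations are distinguished by edge sets). A 2-switch in a graph replaces edges $ab,cd$ by non-edges $ad,bc$ (with $a,b,c,d$ distinct, $ab,cd$ edges and $ad,bc$ non-edges). The realization graph $\mathscr{G}(d)$ has the realizations of $d$ as vertices, two being adjacent iff one is obtained from the other by one 2-switch. A splitted sequence $(\beta;\gamma)$ is the degree sequence of a split graph with a fixed partition into a clique (degrees listed in $\beta$) and an independent set (degrees listed in $\gamma$); $\mathscr{G}((\beta;\gamma))$ means the realization graph of the sequence consisting of all terms of $\beta$ and $\gamma$. For a list $\ell$, $|\ell|$ is its length. Composition of a splitted sequence with a degree sequence: $(p_2;p_1)\circ q$ is obtained by concatenating $p_2,p_1,q$, adding $|q|$ to each term of $p_2$ and $|p_2|$ to each term of $q$, and sorting. Composition of two splitted sequences: $(p_2;p_1)\circ(r_2;r_1)$ is the splitted sequence whose clique part consists of the terms of $p_2$ each increased by $|r_2|+|r_1|$ together with the terms of $r_2$ each increased by $|p_2|$, and whose independent part consists of the terms of $r_1$ each increased by $|p_2|$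 together with the terms of $p_1$. This composition is associative. A (splitted or ordinary) degree sequence is indecomposable if it cannot be expressed as a composition of two such sequences each of strictly smaller length. By a theorem of Tyshkevich, every degree sequence $d$ can be written uniquely as $d=\alpha_1\circ\cdots\circ\alpha_k\circ d_0$ ($k\ge 0$) where each $\alpha_i=(\beta_i;\gamma_i)$ is an indecomposable splitted sequence and $d_0$ is an indecomposable degree sequence; this is the canonical decomposition of $d$. -}

module Defs where

open import Data.Bool using (Bool; true; false; T; _∧_; _∨_; not; if_then_else_)
open import Data.Nat using (ℕ; zero; suc; _+_; _≤_; _<_; _≥_; _≡ᵇ_; _≤ᵇ_)
open import Data.Fin using (Fin; toℕ)
open import Data.Vec using (Vec)
import Data.Vec as V
open import Data.List using (List; []; _∷_; length; map; _++_; foldr; allFin)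
import Data.List as L
open import Data.List.Relation.Unary.All using (All)
open import Data.List.Relation.Unary.Linked using (Linked)
open import Data.Product using (Σ; ∃; _×_; _,_; proj₁)
open import Data.Sum using (_⊎_)
open import Relation.Binary.PropositionalEquality using (_≡_)
open import Relation.Nullary using (¬_)
open import Function.Bundles using (_↔_; _⇔_; Inverse)

-- Graphs on vertex set Fin n, as adjacency matrices (structural equality
-- of matrices = equality of edge sets).

Mat : ℕ → Set
Mat n = Vec (Vec Bool n) n

adj : ∀ {n} → Mat n → Fin n → Fin n → Bool
adj A i j = V.lookup (V.lookup A i) j

allF : ∀ {n} → (Fin n → Bool) → Bool
allF {n} p = foldr (λ x b → p x ∧ b) true (allFin n)

_==F_ : ∀ {n} → Fin n → Fin n → Bool
i ==F j = toℕ i ≡ᵇ toℕ j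

_==B_ : Bool → Bool → Bool
true  ==B b = b
false ==B b = not b

countTrue : ∀ {m} → Vec Bool m → ℕ
countTrue V.[] = 0
countTrue (true V.∷ bs) = suc (countTrue bs)
countTrue (false V.∷ bs) = countTrue bs

degree : ∀ {n} → Mat n → Fin n → ℕ
degree A i = countTrue (V.lookup A i)

isSimple : ∀ {n} → Mat n → Bool
isSimple A = allF λ i → not (adj A i i) ∧ allF λ j → adj A i j ==B adj A j i

isRealization : (d : List ℕ) → Mat (length d) → Bool
isRealization d A = isSimple A ∧ allF λ i → degree A i ≡ᵇ L.lookup d i

Realization : List ℕ → Set
Realization d = Σ (Mat (length d)) λ A → T (isRealization d A)

pairIs : ∀ {n} → Fin n → Fin n → Fin n → Fin n → Bool
pairIs i j x y = (i ==F x ∧ j ==F y) ∨ (i ==F y ∧ j ==F x)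

switched : ∀ {n} → Mat n → Fin n → Fin n → Fin n → Fin n → Fin n → Fin n → Bool
switched A a b c e i j =
  if pairIs i j a b ∨ pairIs i j c e then false
  else if pairIs i j a e ∨ pairIs i j b c then true
  else adj A i j

TwoSwitch : ∀ {n} → Mat n → Mat n → Set
TwoSwitch {n} A B = Σ (Fin n) λ a → Σ (Fin n) λ b → Σ (Fin n) λ c → Σ (Fin n) λ e →
  ¬ a ≡ b × ¬ a ≡ c × ¬ a ≡ e × ¬ b ≡ c × ¬ b ≡ e × ¬ c ≡ e ×
  adj A a b ≡ true × adj A c e ≡ true × adj A a e ≡ false × adj A b c ≡ false ×
  (∀ i j → adj B i j ≡ switched A a b c e i j)

record Graph : Set₁ where
  field
    V   : Set
    Adj : V → V → Set
open Graph public

record _≅_ (G H : Graph) : Set where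
  field
    bij : V G ↔ V H
    preserves : ∀ x y → Adj G x y ⇔ Adj H (Inverse.to bij x) (Inverse.to bij y)

_□_ : Graph → Graph → Graph
G □ H = record
  { V = V G × V H
  ; Adj = λ { (x , y) (x' , y') → (x ≡ x' × Adj H y y') ⊎ (Adj G x x' × y ≡ y') } }

RG : List ℕ → Graph
RG d = record
  { V = Realization d
  ; Adj = λ r s → TwoSwitch (proj₁ r) (proj₁ s) ⊎ TwoSwitch (proj₁ s) (proj₁ r) }

Descending : List ℕ → Set
Descending = Linked _≥_

IsDegreeSequence : List ℕ → Set
IsDegreeSequence d = Descending d × Realization d

Splitted : Set
Splitted = List ℕ × List ℕ

slen : Splitted → ℕ
slen (β , γ) = length β + length γ

-- realization of β ++ γ in which vertices 0..|β|-1 form a clique and the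
-- remaining vertices form an independent set
isSplitRealization : (β γ : List ℕ) → Mat (length (β ++ γ)) → Bool
isSplitRealization β γ A = isRealization (β ++ γ) A ∧
  (allF λ i → allF λ j →
     if i ==F j then true
     else if (suc (toℕ i) ≤ᵇ length β) ∧ (suc (toℕ j) ≤ᵇ length β) then adj A i j
     else if not (suc (toℕ i) ≤ᵇ length β) ∧ not (suc (toℕ j) ≤ᵇ length β) then not (adj A i j)
     else true)

IsSplitted : Splitted → Set
IsSplitted (β , γ) = Descending β × Descending γ ×
  Σ (Mat (length (β ++ γ))) λ A → T (isSplitRealization β γ A)

insertD : ℕ → List ℕ → List ℕ
insertD x [] = x ∷ []
insertD x (y ∷ ys) = if y ≤ᵇ x then x ∷ y ∷ ys else y ∷ insertD x ys

sortD : List ℕ → List ℕ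
sortD = foldr insertD []

sseq : Splitted → List ℕ
sseq (β , γ) = sortD (β ++ γ)

_∘ds_ : Splitted → List ℕ → List ℕ
(p2 , p1) ∘ds q = sortD (map (_+ length q) p2 ++ p1 ++ map (_+ length p2) q)

_∘ss_ : Splitted → Splitted → Splitted
(p2 , p1) ∘ss (r2 , r1) =
  sortD (map (_+ (length r2 + length r1)) p2 ++ map (_+ length p2) r2) ,
  sortD (map (_+ length p2) r1 ++ p1)

IndecomposableDS : List ℕ → Set
IndecomposableDS q = ¬ (Σ Splitted λ p → Σ (List ℕ) λ q' →
  IsSplitted p × IsDegreeSequence q' × slen p < length q × length q' < length q ×
  q ≡ p ∘ds q')

IndecomposableSS : Splitted → Set
IndecomposableSS r = ¬ (Σ Splitted λ p → Σ Splitted λ r' →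
  IsSplitted p × IsSplitted r' × slen p < slen r × slen r' < slen r ×
  r ≡ p ∘ss r')

IsCanonicalDecomposition : List ℕ → List Splitted → List ℕ → Set
IsCanonicalDecomposition d αs d₀ =
  All (λ α → IsSplitted α × IndecomposableSS α) αs ×
  IsDegreeSequence d₀ × 1 ≤ length d₀ × IndecomposableDS d₀ ×
  d ≡ foldr _∘ds_ d₀ αs

productRG : List Splitted → List ℕ → Graph
productRG αs d₀ = foldr (λ α G → RG (sseq α) □ G) (RG d₀) αs

-- Write d = (β ; γ) ∘ q and split its vertices into T (degrees β + |q|), M (degrees q + |β|) and
-- B (degrees γ). Summing the degrees over T and comparing with the degree sum of a split realization
-- of (β ; γ) shows that in every realization of d each vertex of T is adjacent to all of M and no
-- vertex of B is adjacent to M. Hence a realization of d is the same as a realization of (β ; γ)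
-- on T ∪ B together with one of q on M, and since all realizations agree on the pairs joining
-- T ∪ B to M, every 2-switch takes place inside one of the two parts. This gives
-- 𝒢((β ; γ) ∘ q) ≅ 𝒢(β ; γ) □ 𝒢(q), and the theorem follows by induction on the decomposition.
module Submission where

open import Defs
open import Data.Bool using (Bool; true; false; T; _∧_; not; if_then_else_)
open import Data.Bool.Properties using (T-∧; T-≡; T-not-≡; T-irrelevant; ∧-zeroʳ; ∨-zeroʳ)
open import Data.Empty using (⊥-elim)
open import Data.Fin using (Fin; zero; suc; toℕ; splitAt)
import Data.Fin.Properties as Fin
open import Data.Fin.Properties using (+↔⊎)
open import Data.List using (List; []; _∷_; length; map; _++_; foldr)
import Data.List as List
open import Data.List.Relation.Binary.Permutation.Propositional
  using (_↭_; ↭-refl; ↭-sym; ↭-trans; ↭-prep; ↭-swap; ↭⇒↭ₛ)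
open import Data.List.Relation.Binary.Permutation.Propositional.Properties using (All-resp-↭; ++⁺ˡ; ++-comm)
open import Data.List.Relation.Binary.Pointwise using (Pointwise-≡⇒≡)
open import Data.List.Relation.Unary.All using (All; []; _∷_)
import Data.List.Relation.Unary.All as All
import Data.List.Relation.Unary.All.Properties as All
open import Data.List.Relation.Unary.AllPairs using (AllPairs; []; _∷_)
import Data.List.Relation.Unary.AllPairs as AllPairs
import Data.List.Relation.Unary.AllPairs.Properties as AllPairs
open import Data.List.Relation.Unary.Linked.Properties using (AllPairs⇒Linked; Linked⇒AllPairs)
open import Data.List.Relation.Unary.Sorted.TotalOrder.Properties using (↗↭↗⇒≋)
open import Data.Nat using (ℕ; zero; suc; _+_; _≤_; _<_; _≥_; _≡ᵇ_; _≤ᵇ_; z≤n; s≤s)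
open import Data.Nat.Properties
open import Algebra.Properties.CommutativeMonoid.Sum +-0-commutativeMonoid
  using (sum; sum-cong-≗; ∑-comm; ∑-distrib-+; ∑-permute)
open import Data.Product using (Σ; _×_; _,_; proj₁; proj₂)
import Data.Product as Product
open import Data.Sum using (_⊎_; inj₁; inj₂; [_,_])
import Data.Sum as Sum
open import Data.Sum.Algebra using (⊎-comm)
open import Data.Sum.Function.Propositional using (_⊎-↔_)
open import Data.Unit using (tt)
open import Data.Vec using (Vec)
import Data.Vec as Vec
import Data.Vec.Properties as Vec
open import Function using (_∘_; id)
open import Function.Bundles using (_↔_; _⇔_; mk⇔; Equivalence; Inverse; Injection; mk↔ₛ′)
open import Function.Properties.Inverse using (↔-refl; ↔-sym; ↔-trans; ↔⇒↣)
import Relation.Binary.Construct.Flip.EqAndOrd as Flip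
open import Relation.Binary.PropositionalEquality hiding ([_])
open import Relation.Nullary using (¬_; yes; no)

bool→ℕ : Bool → ℕ
bool→ℕ true  = 1
bool→ℕ false = 0

bool→ℕ≤1 : ∀ b → bool→ℕ b ≤ 1
bool→ℕ≤1 true  = s≤s z≤n
bool→ℕ≤1 false = z≤n

count : ∀ {n} → (Fin n → Bool) → ℕ
count f = sum (bool→ℕ ∘ f)

countTrue≡count : ∀ {n} (v : Vec Bool n) → countTrue v ≡ count (Vec.lookup v)
countTrue≡count Vec.[]           = refl
countTrue≡count (true Vec.∷ v)  = cong suc (countTrue≡count v)
countTrue≡count (false Vec.∷ v) = countTrue≡count v

sum-ones : ∀ n → sum {n} (λ _ → 1) ≡ n
sum-ones zero    = refl
sum-ones (suc n) = cong suc (sum-ones n)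

sum-zeros : ∀ n → sum {n} (λ _ → 0) ≡ 0
sum-zeros zero    = refl
sum-zeros (suc n) = sum-zeros n

sum-mono-≤ : ∀ {n} {f g : Fin n → ℕ} → (∀ i → f i ≤ g i) → sum f ≤ sum g
sum-mono-≤ {zero}  f≤g = z≤n
sum-mono-≤ {suc n} f≤g = +-mono-≤ (f≤g zero) (sum-mono-≤ (f≤g ∘ suc))

sum-mono-≤-≡⇒≗ : ∀ {n} {f g : Fin n → ℕ} → (∀ i → f i ≤ g i) → sum f ≡ sum g → ∀ i → f i ≡ g i
sum-mono-≤-≡⇒≗ {suc n} {f} {g} f≤g eq zero =
  ≤-antisym (f≤g zero) (+-cancelʳ-≤ (sum (g ∘ suc)) (g zero) (f zero) (begin
    g zero + sum (g ∘ suc) ≡⟨ sym eq ⟩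
    f zero + sum (f ∘ suc) ≤⟨ +-monoʳ-≤ (f zero) (sum-mono-≤ (f≤g ∘ suc)) ⟩
    f zero + sum (g ∘ suc) ∎))
  where open ≤-Reasoning
sum-mono-≤-≡⇒≗ {suc n} {f} {g} f≤g eq (suc i) =
  sum-mono-≤-≡⇒≗ (f≤g ∘ suc) (≤-antisym (sum-mono-≤ (f≤g ∘ suc))
    (+-cancelˡ-≤ (f zero) _ _ (begin
      f zero + sum (g ∘ suc) ≤⟨ +-monoˡ-≤ (sum (g ∘ suc)) (f≤g zero) ⟩
      g zero + sum (g ∘ suc) ≡⟨ sym eq ⟩
      f zero + sum (f ∘ suc) ∎))) i
  where open ≤-Reasoning

count-cong : ∀ {n} {f g : Fin n → Bool} → (∀ i → f i ≡ g i) → count f ≡ count g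
count-cong f≗g = sum-cong-≗ (cong bool→ℕ ∘ f≗g)

count≤n : ∀ {n} (f : Fin n → Bool) → count f ≤ n
count≤n {n} f = begin
  count f          ≤⟨ sum-mono-≤ (bool→ℕ≤1 ∘ f) ⟩
  sum {n} (λ _ → 1) ≡⟨ sum-ones n ⟩
  n                ∎
  where open ≤-Reasoning

count-true : ∀ {n} (f : Fin n → Bool) → (∀ i → f i ≡ true) → count f ≡ n
count-true {n} f f≗true = trans (sum-cong-≗ (cong bool→ℕ ∘ f≗true)) (sum-ones n)

count-false : ∀ {n} (f : Fin n → Bool) → (∀ i → f i ≡ false) → count f ≡ 0
count-false {n} f f≗false = trans (sum-cong-≗ (cong bool→ℕ ∘ f≗false)) (sum-zeros n)

count≡n⇒true : ∀ {n} (f : Fin n → Bool) → count f ≡ n → ∀ i → f i ≡ true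
count≡n⇒true {n} f eq i with f i | sum-mono-≤-≡⇒≗ (bool→ℕ≤1 ∘ f) (trans eq (sym (sum-ones n))) i
... | true | _ = refl

count≡0⇒false : ∀ {n} (f : Fin n → Bool) → count f ≡ 0 → ∀ i → f i ≡ false
count≡0⇒false {n} f eq i with f i | sum-mono-≤-≡⇒≗ {g = bool→ℕ ∘ f} (λ _ → z≤n) (trans (sum-zeros n) (sym eq)) i
... | false | _ = refl

count-pos : ∀ {n} (f : Fin n → Bool) i → f i ≡ true → 0 < count f
count-pos f zero    fi≡true rewrite fi≡true = s≤s z≤n
count-pos f (suc i) fi≡true = ≤-trans (count-pos (f ∘ suc) i fi≡true) (m≤n+m _ (bool→ℕ (f zero)))

count-< : ∀ {n} (f : Fin n → Bool) i → f i ≡ false → count f < n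
count-< f zero    fi≡false rewrite fi≡false = s≤s (count≤n (f ∘ suc))
count-< f (suc i) fi≡false =
  ≤-trans (≤-reflexive (sym (+-suc (bool→ℕ (f zero)) _)))
          (+-mono-≤ (bool→ℕ≤1 (f zero)) (count-< (f ∘ suc) i fi≡false))

count-allBut-≥ : ∀ {n} (f : Fin n → Bool) i → (∀ j → ¬ j ≡ i → f j ≡ true) → n ≤ suc (count f)
count-allBut-≥ {suc n} f zero others =
  s≤s (≤-trans (≤-reflexive (sym (count-true (f ∘ suc) (λ j → others (suc j) λ ())))) (m≤n+m _ (bool→ℕ (f zero))))
count-allBut-≥ {suc n} f (suc i) others rewrite others zero (λ ()) =
  s≤s (count-allBut-≥ (f ∘ suc) i (λ j j≢i → others (suc j) (j≢i ∘ Fin.suc-injective)))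

+-squeeze : ∀ {a b c A B C} → a ≤ A → b ≤ B → c ≤ C → a + b + c ≡ A + B + C → b ≡ B × c ≡ C
+-squeeze {a} {b} {c} {A} {B} {C} a≤A b≤B c≤C eq =
  ≤-antisym b≤B (+-cancelˡ-≤ A _ _ (+-cancelʳ-≤ C _ _ (begin
    A + B + C ≡⟨ sym eq ⟩
    a + b + c ≤⟨ +-mono-≤ (+-monoˡ-≤ b a≤A) c≤C ⟩
    A + b + C ∎))) ,
  ≤-antisym c≤C (+-cancelˡ-≤ (A + B) _ _ (begin
    A + B + C ≡⟨ sym eq ⟩
    a + b + c ≤⟨ +-monoˡ-≤ c (+-mono-≤ a≤A b≤B) ⟩
    A + B + c ∎))
  where open ≤-Reasoning

T-foldr-∧ : ∀ {n} {X : Set} (p : X → Bool) (g : Fin n → X) →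
  T (foldr (λ x b → p x ∧ b) true (List.tabulate g)) ⇔ (∀ i → T (p (g i)))
T-foldr-∧ {zero}  p g = mk⇔ (λ _ ()) (λ _ → tt)
T-foldr-∧ {suc n} p g = mk⇔
  (λ t → let (head , rest) = Equivalence.to T-∧ t in
         λ { zero → head ; (suc i) → Equivalence.to (T-foldr-∧ p (g ∘ suc)) rest i })
  (λ all → Equivalence.from T-∧ (all zero , Equivalence.from (T-foldr-∧ p (g ∘ suc)) (all ∘ suc)))

T-allF⇔ : ∀ {n} (p : Fin n → Bool) → T (allF p) ⇔ (∀ i → T (p i))
T-allF⇔ p = T-foldr-∧ p id

T-==B⇔ : ∀ {b c} → T (b ==B c) ⇔ (b ≡ c)
T-==B⇔ {true}  {true}  = mk⇔ (λ _ → refl) (λ _ → tt)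
T-==B⇔ {true}  {false} = mk⇔ (λ ()) (λ ())
T-==B⇔ {false} {true}  = mk⇔ (λ ()) (λ ())
T-==B⇔ {false} {false} = mk⇔ (λ _ → refl) (λ _ → tt)

==F-≡ : ∀ {n} {i j : Fin n} → i ≡ j → (i ==F j) ≡ true
==F-≡ {i = i} refl = Equivalence.to T-≡ (≡⇒≡ᵇ (toℕ i) (toℕ i) refl)

==F-≢ : ∀ {n} {i j : Fin n} → ¬ i ≡ j → (i ==F j) ≡ false
==F-≢ {i = i} {j} i≢j with i ==F j in eq
... | true  = ⊥-elim (i≢j (Fin.toℕ-injective (≡ᵇ⇒≡ (toℕ i) (toℕ j) (Equivalence.from T-≡ eq))))
... | false = refl

Mat-tabulate : ∀ {n} → (Fin n → Fin n → Bool) → Mat n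
Mat-tabulate f = Vec.tabulate (λ i → Vec.tabulate (f i))

adj-tabulate : ∀ {n} (f : Fin n → Fin n → Bool) i j → adj (Mat-tabulate f) i j ≡ f i j
adj-tabulate f i j rewrite Vec.lookup∘tabulate (λ i → Vec.tabulate (f i)) i = Vec.lookup∘tabulate (f i) j

Mat-ext : ∀ {n} {A B : Mat n} → (∀ i j → adj A i j ≡ adj B i j) → A ≡ B
Mat-ext {A = A} {B} A≗B = begin
  A                     ≡⟨ sym (tabulate-adj A) ⟩
  Mat-tabulate (adj A) ≡⟨ Vec.tabulate-cong (λ i → Vec.tabulate-cong (A≗B i)) ⟩
  Mat-tabulate (adj B) ≡⟨ tabulate-adj B ⟩
  B                     ∎
  where
  open ≡-Reasoning
  tabulate-adj : ∀ M → Mat-tabulate (adj M) ≡ M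
  tabulate-adj M = trans (Vec.tabulate-cong (λ i → Vec.tabulate∘lookup (Vec.lookup M i))) (Vec.tabulate∘lookup M)

-- RG d is definitionally RealizationGraph (length d) (List.lookup d).

isRealizationOf : ∀ {n} → (Fin n → ℕ) → Mat n → Bool
isRealizationOf D A = isSimple A ∧ allF λ i → degree A i ≡ᵇ D i

Realizations : ∀ n → (Fin n → ℕ) → Set
Realizations n D = Σ (Mat n) λ A → T (isRealizationOf D A)

RealizationGraph : ∀ n → (Fin n → ℕ) → Graph
RealizationGraph n D = record
  { V   = Realizations n D
  ; Adj = λ r s → TwoSwitch (proj₁ r) (proj₁ s) ⊎ TwoSwitch (proj₁ s) (proj₁ r) }

record Realizes {n} (D : Fin n → ℕ) (A : Mat n) : Set where
  field
    loopless  : ∀ i → adj A i i ≡ false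
    symmetric : ∀ i j → adj A i j ≡ adj A j i
    degree≡   : ∀ i → count (adj A i) ≡ D i

T-isRealizationOf⇔ : ∀ {n} (D : Fin n → ℕ) (A : Mat n) → T (isRealizationOf D A) ⇔ Realizes D A
T-isRealizationOf⇔ {n} D A = mk⇔ to from
  where
  rowᵇ : Fin n → Bool
  rowᵇ i = not (adj A i i) ∧ allF λ j → adj A i j ==B adj A j i

  to : T (isRealizationOf D A) → Realizes D A
  to t = record
    { loopless  = λ i → Equivalence.to T-not-≡ (proj₁ (row i))
    ; symmetric = λ i j → Equivalence.to T-==B⇔ (Equivalence.to (T-allF⇔ _) (proj₂ (row i)) j)
    ; degree≡   = λ i → trans (sym (countTrue≡count (Vec.lookup A i)))
                              (≡ᵇ⇒≡ _ _ (Equivalence.to (T-allF⇔ _) (proj₂ (Equivalence.to T-∧ t)) i)) }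
    where
    row : ∀ i → T (not (adj A i i)) × T (allF λ j → adj A i j ==B adj A j i)
    row i = Equivalence.to T-∧ (Equivalence.to (T-allF⇔ rowᵇ) (proj₁ (Equivalence.to T-∧ t)) i)

  from : Realizes D A → T (isRealizationOf D A)
  from r = Equivalence.from T-∧
    ( Equivalence.from (T-allF⇔ rowᵇ) (λ i → Equivalence.from T-∧
        ( Equivalence.from T-not-≡ (loopless i)
        , Equivalence.from (T-allF⇔ _) (λ j → Equivalence.from T-==B⇔ (symmetric i j))))
    , Equivalence.from (T-allF⇔ _) (λ i → ≡⇒≡ᵇ _ _ (trans (countTrue≡count (Vec.lookup A i)) (degree≡ i))))
    where open Realizes r

realizes : ∀ {n} {D : Fin n → ℕ} (r : Realizations n D) → Realizes D (proj₁ r)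
realizes {D = D} (A , t) = Equivalence.to (T-isRealizationOf⇔ D A) t

realization : ∀ {n} {D : Fin n → ℕ} {A} → Realizes D A → Realizations n D
realization {D = D} {A} r = A , Equivalence.from (T-isRealizationOf⇔ D A) r

Realizes⇒degree< : ∀ {n} {D : Fin n → ℕ} {A} → Realizes D A → ∀ i → D i < n
Realizes⇒degree< A-realizes i =
  subst (_< _) (Realizes.degree≡ A-realizes i) (count-< _ i (Realizes.loopless A-realizes i))

realization-≡ : ∀ {n} {D : Fin n → ℕ} {r s : Realizations n D} → proj₁ r ≡ proj₁ s → r ≡ s
realization-≡ {r = A , p} {s = .A , q} refl = cong (A ,_) (T-irrelevant p q)

≅-refl : ∀ {G} → G ≅ G
≅-refl = record { bij = mk↔ₛ′ id id (λ _ → refl) (λ _ → refl) ; preserves = λ _ _ → mk⇔ id id }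

≅-to : ∀ {G H} → G ≅ H → V G → V H
≅-to p = Inverse.to (_≅_.bij p)

≅-from : ∀ {G H} → G ≅ H → V H → V G
≅-from p = Inverse.from (_≅_.bij p)

≅-trans : ∀ {G H K} → G ≅ H → H ≅ K → G ≅ K
≅-trans p q = record
  { bij = mk↔ₛ′ (≅-to q ∘ ≅-to p) (≅-from p ∘ ≅-from q)
      (λ z → trans (cong (≅-to q) (strictlyInverseˡ (bij p) (≅-from q z))) (strictlyInverseˡ (bij q) z))
      (λ x → trans (cong (≅-from p) (strictlyInverseʳ (bij q) (≅-to p x))) (strictlyInverseʳ (bij p) x))
  ; preserves = λ x y → mk⇔
      (Equivalence.to (preserves q (≅-to p x) (≅-to p y)) ∘ Equivalence.to (preserves p x y))
      (Equivalence.from (preserves p x y) ∘ Equivalence.from (preserves q (≅-to p x) (≅-to p y))) }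
  where
  open _≅_
  open Inverse using (strictlyInverseˡ; strictlyInverseʳ)

↔-injective : ∀ {A B : Set} (f : A ↔ B) {x y} → Inverse.to f x ≡ Inverse.to f y → x ≡ y
↔-injective f = Injection.injective (↔⇒↣ f)

□-cong : ∀ {G G′ H H′} → G ≅ G′ → H ≅ H′ → (G □ H) ≅ (G′ □ H′)
□-cong p q = record
  { bij = mk↔ₛ′ (λ (x , y) → ≅-to p x , ≅-to q y) (λ (x , y) → ≅-from p x , ≅-from q y)
      (λ (x , y) → cong₂ _,_ (strictlyInverseˡ (bij p) x) (strictlyInverseˡ (bij q) y))
      (λ (x , y) → cong₂ _,_ (strictlyInverseʳ (bij p) x) (strictlyInverseʳ (bij q) y))
  ; preserves = λ (x , y) (x′ , y′) → mk⇔
      (λ { (inj₁ (x≡x′ , y~y′)) → inj₁ (cong (≅-to p) x≡x′ , Equivalence.to (preserves q y y′) y~y′)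
         ; (inj₂ (x~x′ , y≡y′)) → inj₂ (Equivalence.to (preserves p x x′) x~x′ , cong (≅-to q) y≡y′) })
      (λ { (inj₁ (x≡x′ , y~y′)) → inj₁ (↔-injective (bij p) x≡x′ , Equivalence.from (preserves q y y′) y~y′)
         ; (inj₂ (x~x′ , y≡y′)) → inj₂ (Equivalence.from (preserves p x x′) x~x′ , ↔-injective (bij q) y≡y′) }) }
  where
  open _≅_
  open Inverse using (strictlyInverseˡ; strictlyInverseʳ)

sum-splitAt : ∀ a {b} (f : Fin a ⊎ Fin b → ℕ) → sum (f ∘ splitAt a) ≡ sum (f ∘ inj₁) + sum (f ∘ inj₂)
sum-splitAt zero    f = refl
sum-splitAt (suc a) f = trans (cong (f (inj₁ zero) +_) (sum-splitAt a (f ∘ Sum.map₁ suc)))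
                              (sym (+-assoc (f (inj₁ zero)) _ _))

module Blocks {n a b : ℕ} (P : Fin n ↔ (Fin a ⊎ Fin b)) where
  open Inverse P using (to; from; strictlyInverseˡ; strictlyInverseʳ)

  ι₁ : Fin a → Fin n
  ι₁ = from ∘ inj₁

  ι₂ : Fin b → Fin n
  ι₂ = from ∘ inj₂

  data Block : Fin n → Set where
    first  : ∀ u → Block (ι₁ u)
    second : ∀ v → Block (ι₂ v)

  block : ∀ x → Block x
  block x with to x | strictlyInverseʳ x
  ... | inj₁ u | refl = first u
  ... | inj₂ v | refl = second v

  ι₁-injective : ∀ {u u′} → ι₁ u ≡ ι₁ u′ → u ≡ u′
  ι₁-injective {u} {u′} e with trans (sym (strictlyInverseˡ (inj₁ u))) (trans (cong to e) (strictlyInverseˡ (inj₁ u′)))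
  ... | refl = refl

  ι₂-injective : ∀ {v v′} → ι₂ v ≡ ι₂ v′ → v ≡ v′
  ι₂-injective {v} {v′} e with trans (sym (strictlyInverseˡ (inj₂ v))) (trans (cong to e) (strictlyInverseˡ (inj₂ v′)))
  ... | refl = refl

  ι₁≢ι₂ : ∀ {u v} → ¬ ι₁ u ≡ ι₂ v
  ι₁≢ι₂ {u} {v} e with trans (sym (strictlyInverseˡ (inj₁ u))) (trans (cong to e) (strictlyInverseˡ (inj₂ v)))
  ... | ()

  sum-blocks : ∀ (h : Fin n → ℕ) → sum h ≡ sum (h ∘ ι₁) + sum (h ∘ ι₂)
  sum-blocks h = trans (∑-permute h (↔-trans +↔⊎ (↔-sym P))) (sum-splitAt a (h ∘ from))

  count-blocks : ∀ (f : Fin n → Bool) → count f ≡ count (f ∘ ι₁) + count (f ∘ ι₂)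
  count-blocks f = sum-blocks (bool→ℕ ∘ f)

restrict : ∀ {n a} → (Fin a → Fin n) → Mat n → Mat a
restrict f A = Mat-tabulate λ u v → adj A (f u) (f v)

adj-restrict : ∀ {n a} (f : Fin a → Fin n) (A : Mat n) u v → adj (restrict f A) u v ≡ adj A (f u) (f v)
adj-restrict f A = adj-tabulate λ u v → adj A (f u) (f v)

record SwitchAt {n} (A B : Mat n) (a b c e : Fin n) : Set where
  field
    a≢b : ¬ a ≡ b
    a≢c : ¬ a ≡ c
    a≢e : ¬ a ≡ e
    b≢c : ¬ b ≡ c
    b≢e : ¬ b ≡ e
    c≢e : ¬ c ≡ e
    A-ab : adj A a b ≡ true
    A-ce : adj A c e ≡ true
    A-ae : adj A a e ≡ false
    A-bc : adj A b c ≡ false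
    B≗switched : ∀ i j → adj B i j ≡ switched A a b c e i j

SwitchAt⇒TwoSwitch : ∀ {n} {A B : Mat n} {a b c e} → SwitchAt A B a b c e → TwoSwitch A B
SwitchAt⇒TwoSwitch {a = a} {b} {c} {e} s =
  a , b , c , e , a≢b , a≢c , a≢e , b≢c , b≢e , c≢e , A-ab , A-ce , A-ae , A-bc , B≗switched
  where open SwitchAt s

TwoSwitch⇒SwitchAt : ∀ {n} {A B : Mat n} → TwoSwitch A B →
  Σ (Fin n × Fin n × Fin n × Fin n) λ (a , b , c , e) → SwitchAt A B a b c e
TwoSwitch⇒SwitchAt (a , b , c , e , a≢b , a≢c , a≢e , b≢c , b≢e , c≢e , A-ab , A-ce , A-ae , A-bc , B≗switched) =
  (a , b , c , e) , record
    { a≢b = a≢b ; a≢c = a≢c ; a≢e = a≢e ; b≢c = b≢c ; b≢e = b≢e ; c≢e = c≢e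
    ; A-ab = A-ab ; A-ce = A-ce ; A-ae = A-ae ; A-bc = A-bc ; B≗switched = B≗switched }

pairIs-≢ʳ : ∀ {n} (i j x y : Fin n) → ¬ j ≡ x → ¬ j ≡ y → pairIs i j x y ≡ false
pairIs-≢ʳ i j x y j≢x j≢y rewrite ==F-≢ j≢x | ==F-≢ j≢y | ∧-zeroʳ (i ==F x) | ∧-zeroʳ (i ==F y) = refl

pairIs-≢ˡ : ∀ {n} (i j x y : Fin n) → ¬ i ≡ x → ¬ i ≡ y → pairIs i j x y ≡ false
pairIs-≢ˡ i j x y i≢x i≢y rewrite ==F-≢ i≢x | ==F-≢ i≢y = refl

pairIs-refl : ∀ {n} (i j : Fin n) → pairIs i j i j ≡ true
pairIs-refl i j rewrite ==F-≡ {i = i} refl | ==F-≡ {i = j} refl = refl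

==F-injective : ∀ {n a} {f : Fin a → Fin n} → (∀ {u v} → f u ≡ f v → u ≡ v) → ∀ u v → (f u ==F f v) ≡ (u ==F v)
==F-injective {f = f} f-inj u v with u Fin.≟ v
... | yes refl = trans (==F-≡ {i = f u} refl) (sym (==F-≡ {i = u} refl))
... | no u≢v   = trans (==F-≢ (u≢v ∘ f-inj)) (sym (==F-≢ u≢v))

pairIs-injective : ∀ {n a} {f : Fin a → Fin n} → (∀ {u v} → f u ≡ f v → u ≡ v) →
  ∀ i j x y → pairIs (f i) (f j) (f x) (f y) ≡ pairIs i j x y
pairIs-injective f-inj i j x y
  rewrite ==F-injective f-inj i x | ==F-injective f-inj j y | ==F-injective f-inj i y | ==F-injective f-inj j x = refl

switched-restrict : ∀ {n a} {f : Fin a → Fin n} → (∀ {u v} → f u ≡ f v → u ≡ v) → ∀ A a b c e i j →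
  switched A (f a) (f b) (f c) (f e) (f i) (f j) ≡ switched (restrict f A) a b c e i j
switched-restrict {f = f} f-inj A a b c e i j
  rewrite pairIs-injective f-inj i j a b | pairIs-injective f-inj i j c e
        | pairIs-injective f-inj i j a e | pairIs-injective f-inj i j b c
        | adj-restrict f A i j = refl

switched-awayʳ : ∀ {n} (A : Mat n) {a b c e} i j → ¬ j ≡ a → ¬ j ≡ b → ¬ j ≡ c → ¬ j ≡ e →
  switched A a b c e i j ≡ adj A i j
switched-awayʳ A {a} {b} {c} {e} i j j≢a j≢b j≢c j≢e
  rewrite pairIs-≢ʳ i j a b j≢a j≢b | pairIs-≢ʳ i j c e j≢c j≢e
        | pairIs-≢ʳ i j a e j≢a j≢e | pairIs-≢ʳ i j b c j≢b j≢c = refl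

switched-awayˡ : ∀ {n} (A : Mat n) {a b c e} i j → ¬ i ≡ a → ¬ i ≡ b → ¬ i ≡ c → ¬ i ≡ e →
  switched A a b c e i j ≡ adj A i j
switched-awayˡ A {a} {b} {c} {e} i j i≢a i≢b i≢c i≢e
  rewrite pairIs-≢ˡ i j a b i≢a i≢b | pairIs-≢ˡ i j c e i≢c i≢e
        | pairIs-≢ˡ i j a e i≢a i≢e | pairIs-≢ˡ i j b c i≢b i≢c = refl

module _ {n} {A B : Mat n} {a b c e : Fin n} (s : SwitchAt A B a b c e) where
  open SwitchAt s

  SwitchAt-changes-ab : ¬ adj A a b ≡ adj B a b
  SwitchAt-changes-ab eq with trans (sym A-ab) (trans eq (B≗switched a b))
  ... | e′ rewrite pairIs-refl a b with e′
  ... | ()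

  SwitchAt-changes-ce : ¬ adj A c e ≡ adj B c e
  SwitchAt-changes-ce eq with trans (sym A-ce) (trans eq (B≗switched c e))
  ... | e′ rewrite pairIs-refl c e | ∨-zeroʳ (pairIs c e a b) with e′
  ... | ()

  SwitchAt-changes-ae : ¬ adj A a e ≡ adj B a e
  SwitchAt-changes-ae eq with trans (sym A-ae) (trans eq (B≗switched a e))
  ... | e′ rewrite pairIs-≢ʳ a e a b (a≢e ∘ sym) (b≢e ∘ sym) | pairIs-≢ˡ a e c e a≢c a≢e | pairIs-refl a e with e′
  ... | ()

  SwitchAt-awayʳ : ∀ i j → ¬ j ≡ a → ¬ j ≡ b → ¬ j ≡ c → ¬ j ≡ e → adj B i j ≡ adj A i j
  SwitchAt-awayʳ i j j≢a j≢b j≢c j≢e = trans (B≗switched i j) (switched-awayʳ A i j j≢a j≢b j≢c j≢e)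

SwitchAt-restrict : ∀ {n a} {f : Fin a → Fin n} (f-inj : ∀ {u v} → f u ≡ f v → u ≡ v) {A B : Mat n} {a b c e} →
  SwitchAt A B (f a) (f b) (f c) (f e) → SwitchAt (restrict f A) (restrict f B) a b c e
SwitchAt-restrict {f = f} f-inj {A} {B} {a} {b} {c} {e} s = record
  { a≢b = a≢b ∘ cong f ; a≢c = a≢c ∘ cong f ; a≢e = a≢e ∘ cong f
  ; b≢c = b≢c ∘ cong f ; b≢e = b≢e ∘ cong f ; c≢e = c≢e ∘ cong f
  ; A-ab = trans (adj-restrict f A a b) A-ab ; A-ce = trans (adj-restrict f A c e) A-ce
  ; A-ae = trans (adj-restrict f A a e) A-ae ; A-bc = trans (adj-restrict f A b c) A-bc
  ; B≗switched = λ i j → trans (adj-restrict f B i j)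
                           (trans (B≗switched (f i) (f j)) (switched-restrict f-inj A a b c e i j)) }
  where open SwitchAt s

module SwitchInFirstBlock {n a b : ℕ} (P : Fin n ↔ (Fin a ⊎ Fin b)) {A B : Mat n}
  (cross₁₂ : ∀ u v → adj A (Blocks.ι₁ P u) (Blocks.ι₂ P v) ≡ adj B (Blocks.ι₁ P u) (Blocks.ι₂ P v))
  (cross₂₁ : ∀ v u → adj A (Blocks.ι₂ P v) (Blocks.ι₁ P u) ≡ adj B (Blocks.ι₂ P v) (Blocks.ι₁ P u)) where
  open Blocks P

  SwitchedIn₁ : Set
  SwitchedIn₁ = TwoSwitch (restrict ι₁ A) (restrict ι₁ B) × restrict ι₂ A ≡ restrict ι₂ B

  private
    away : ∀ {v u} → ¬ ι₂ v ≡ ι₁ u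
    away = ι₁≢ι₂ ∘ sym

  SwitchAt₁⇒SwitchedIn₁ : ∀ {a b c e} → SwitchAt A B (ι₁ a) (ι₁ b) (ι₁ c) (ι₁ e) → SwitchedIn₁
  SwitchAt₁⇒SwitchedIn₁ s =
    SwitchAt⇒TwoSwitch (SwitchAt-restrict ι₁-injective {A} {B} s) ,
    Mat-ext λ v v′ → trans (adj-restrict ι₂ A v v′)
      (trans (sym (SwitchAt-awayʳ s (ι₂ v) (ι₂ v′) away away away away))
             (sym (adj-restrict ι₂ B v v′)))

  SwitchedIn₁⇒TwoSwitch : SwitchedIn₁ → TwoSwitch A B
  SwitchedIn₁⇒TwoSwitch (sw , A₂≡B₂) with TwoSwitch⇒SwitchAt {A = restrict ι₁ A} {restrict ι₁ B} sw
  ... | (a , b , c , e) , s = SwitchAt⇒TwoSwitch {A = A} {B} (record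
    { a≢b = a≢b ∘ ι₁-injective ; a≢c = a≢c ∘ ι₁-injective ; a≢e = a≢e ∘ ι₁-injective
    ; b≢c = b≢c ∘ ι₁-injective ; b≢e = b≢e ∘ ι₁-injective ; c≢e = c≢e ∘ ι₁-injective
    ; A-ab = trans (sym (adj-restrict ι₁ A a b)) A-ab ; A-ce = trans (sym (adj-restrict ι₁ A c e)) A-ce
    ; A-ae = trans (sym (adj-restrict ι₁ A a e)) A-ae ; A-bc = trans (sym (adj-restrict ι₁ A b c)) A-bc
    ; B≗switched = λ x y → B≗switched′ (block x) (block y) })
    where
    open SwitchAt s
    B≗switched′ : ∀ {x y} → Block x → Block y → adj B x y ≡ switched A (ι₁ a) (ι₁ b) (ι₁ c) (ι₁ e) x y
    B≗switched′ (first u) (first u′) =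
      trans (sym (adj-restrict ι₁ B u u′)) (trans (B≗switched u u′) (sym (switched-restrict ι₁-injective A a b c e u u′)))
    B≗switched′ (second v) (second v′) =
      trans (sym (adj-restrict ι₂ B v v′)) (trans (cong (λ M → adj M v v′) (sym A₂≡B₂))
        (trans (adj-restrict ι₂ A v v′) (sym (switched-awayʳ A (ι₂ v) (ι₂ v′) away away away away))))
    B≗switched′ (first u) (second v) =
      trans (sym (cross₁₂ u v)) (sym (switched-awayʳ A (ι₁ u) (ι₂ v) away away away away))
    B≗switched′ (second v) (first u) =
      trans (sym (cross₂₁ v u)) (sym (switched-awayˡ A (ι₂ v) (ι₁ u) away away away away))

⊎-swapʳ : ∀ {n a b} → Fin n ↔ (Fin a ⊎ Fin b) → Fin n ↔ (Fin b ⊎ Fin a)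
⊎-swapʳ P = ↔-trans P (⊎-comm _ _)

SwitchedInOneBlock : ∀ {n a b} → Fin n ↔ (Fin a ⊎ Fin b) → Mat n → Mat n → Set
SwitchedInOneBlock P A B =
  (TwoSwitch (restrict ι₁ A) (restrict ι₁ B) × restrict ι₂ A ≡ restrict ι₂ B) ⊎
  (restrict ι₁ A ≡ restrict ι₁ B × TwoSwitch (restrict ι₂ A) (restrict ι₂ B))
  where open Blocks P

TwoSwitch-blocks : ∀ {n a b} (P : Fin n ↔ (Fin a ⊎ Fin b)) {A B : Mat n} → let open Blocks P in
  (∀ u v → adj A (ι₁ u) (ι₂ v) ≡ adj B (ι₁ u) (ι₂ v)) →
  (∀ v u → adj A (ι₂ v) (ι₁ u) ≡ adj B (ι₂ v) (ι₁ u)) →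
  TwoSwitch A B ⇔ SwitchedInOneBlock P A B
TwoSwitch-blocks P {A} {B} cross₁₂ cross₂₁ = mk⇔
  (λ sw → let (_ , s) = TwoSwitch⇒SwitchAt sw in by-blocks (block _) (block _) (block _) (block _) s)
  [ In₁.SwitchedIn₁⇒TwoSwitch , In₂.SwitchedIn₁⇒TwoSwitch ∘ Product.swap ]
  where
  open Blocks P
  module In₁ = SwitchInFirstBlock P {A} {B} cross₁₂ cross₂₁
  module In₂ = SwitchInFirstBlock (⊎-swapʳ P) {A} {B} cross₂₁ cross₁₂
  by-blocks : ∀ {a b c e} → Block a → Block b → Block c → Block e → SwitchAt A B a b c e →
    SwitchedInOneBlock P A B
  by-blocks (first _)  (first _)  (first _)  (first _)  s = inj₁ (In₁.SwitchAt₁⇒SwitchedIn₁ s)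
  by-blocks (second _) (second _) (second _) (second _) s = inj₂ (Product.swap (In₂.SwitchAt₁⇒SwitchedIn₁ s))
  -- each of the pairs ab, ae, ce changes, so none of them joins the two blocks
  by-blocks (first a)  (second b) _ _ s = ⊥-elim (SwitchAt-changes-ab s (cross₁₂ a b))
  by-blocks (second a) (first b)  _ _ s = ⊥-elim (SwitchAt-changes-ab s (cross₂₁ a b))
  by-blocks (first a)  (first _)  _ (second e) s = ⊥-elim (SwitchAt-changes-ae s (cross₁₂ a e))
  by-blocks (second a) (second _) _ (first e)  s = ⊥-elim (SwitchAt-changes-ae s (cross₂₁ a e))
  by-blocks (first _)  (first _)  (second c) (first e)  s = ⊥-elim (SwitchAt-changes-ce s (cross₂₁ c e))
  by-blocks (second _) (second _) (first c)  (second e) s = ⊥-elim (SwitchAt-changes-ce s (cross₁₂ c e))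

record IsSplitRealization {na m l : ℕ} (C : Fin na ↔ (Fin m ⊎ Fin l)) (Dα : Fin na → ℕ) (H : Mat na) : Set where
  open Blocks C using () renaming (ι₁ to κ; ι₂ to ι)
  field
    realizes-Dα : Realizes Dα H
    clique      : ∀ i i′ → ¬ i ≡ i′ → adj H (κ i) (κ i′) ≡ true
    independent : ∀ j j′ → adj H (ι j) (ι j′) ≡ false

module SplitRealization {na m l : ℕ} {C : Fin na ↔ (Fin m ⊎ Fin l)} {Dα : Fin na → ℕ} {H : Mat na}
  (H-split : IsSplitRealization C Dα H) where
  open Blocks C using () renaming (ι₁ to κ; ι₂ to ι; count-blocks to count-sides)
  open IsSplitRealization H-split renaming (clique to H-clique; independent to H-independent)
  open Realizes realizes-Dα

  clique-degree : ∀ i → suc (count λ i′ → adj H (κ i) (κ i′)) ≡ m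
  clique-degree i = ≤-antisym (count-< _ i (loopless (κ i)))
                              (count-allBut-≥ _ i (λ i′ i′≢i → H-clique i i′ (i′≢i ∘ sym)))

  independent-degree : ∀ j → count (λ i → adj H (ι j) (κ i)) ≡ Dα (ι j)
  independent-degree j = begin
    count (λ i → adj H (ι j) (κ i))                                       ≡⟨ sym (+-identityʳ _) ⟩
    count (λ i → adj H (ι j) (κ i)) + 0
      ≡⟨ cong (count (λ i → adj H (ι j) (κ i)) +_) (sym (count-false _ (H-independent j))) ⟩
    count (λ i → adj H (ι j) (κ i)) + count (λ j′ → adj H (ι j) (ι j′)) ≡⟨ sym (count-sides (adj H (ι j))) ⟩
    count (adj H (ι j))                                                    ≡⟨ degree≡ (ι j) ⟩
    Dα (ι j)                                                               ∎
    where open ≡-Reasoning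

  sum-Dα-clique : sum (Dα ∘ κ) ≡ sum (λ i → count λ i′ → adj H (κ i) (κ i′)) + sum (Dα ∘ ι)
  sum-Dα-clique = begin
    sum (Dα ∘ κ)
      ≡⟨ sum-cong-≗ (λ i → trans (sym (degree≡ (κ i))) (count-sides (adj H (κ i)))) ⟩
    sum (λ i → count (λ i′ → adj H (κ i) (κ i′)) + count (λ j → adj H (κ i) (ι j)))
      ≡⟨ ∑-distrib-+ (λ i → count λ i′ → adj H (κ i) (κ i′)) (λ i → count λ j → adj H (κ i) (ι j)) ⟩
    sum (λ i → count λ i′ → adj H (κ i) (κ i′)) + sum (λ i → count λ j → adj H (κ i) (ι j))
      ≡⟨ cong (sum (λ i → count λ i′ → adj H (κ i) (κ i′)) +_) (begin
           sum (λ i → count λ j → adj H (κ i) (ι j)) ≡⟨ ∑-comm (λ i j → bool→ℕ (adj H (κ i) (ι j))) ⟩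
           sum (λ j → count λ i → adj H (κ i) (ι j)) ≡⟨ sum-cong-≗ (λ j → count-cong λ i → symmetric (κ i) (ι j)) ⟩
           sum (λ j → count λ i → adj H (ι j) (κ i)) ≡⟨ sum-cong-≗ independent-degree ⟩
           sum (Dα ∘ ι) ∎) ⟩
    sum (λ i → count λ i′ → adj H (κ i) (κ i′)) + sum (Dα ∘ ι) ∎
    where open ≡-Reasoning

  clique-degree-≥ : ∀ i → m ≤ suc (Dα (κ i))
  clique-degree-≥ i = begin
    m                                                                                ≡⟨ sym (clique-degree i) ⟩
    suc (count λ i′ → adj H (κ i) (κ i′))                                           ≤⟨ s≤s (m≤m+n _ _) ⟩
    suc (count (λ i′ → adj H (κ i) (κ i′)) + count (λ j → adj H (κ i) (ι j)))
      ≡⟨ cong suc (sym (count-sides (adj H (κ i)))) ⟩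
    suc (count (adj H (κ i)))                                                        ≡⟨ cong suc (degree≡ (κ i)) ⟩
    suc (Dα (κ i))                                                                   ∎
    where open ≤-Reasoning

  independent-degree-≤ : ∀ j → Dα (ι j) ≤ m
  independent-degree-≤ j = ≤-trans (≤-reflexive (sym (independent-degree j))) (count≤n _)

  -- If ι j is adjacent to κ i then Dα (ι j) ≤ m ≤ Dα (κ i), otherwise Dα (ι j) < m ≤ 1 + Dα (κ i).
  independent≤clique : ∀ i j → Dα (ι j) ≤ Dα (κ i)
  independent≤clique i j with adj H (ι j) (κ i) in ji
  ... | true  = begin
    Dα (ι j)                                                          ≤⟨ independent-degree-≤ j ⟩
    m                                                                 ≡⟨ sym (clique-degree i) ⟩
    suc (count λ i′ → adj H (κ i) (κ i′))                            ≡⟨ +-comm 1 _ ⟩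
    count (λ i′ → adj H (κ i) (κ i′)) + 1
      ≤⟨ +-monoʳ-≤ _ (count-pos _ j (trans (symmetric (κ i) (ι j)) ji)) ⟩
    count (λ i′ → adj H (κ i) (κ i′)) + count (λ j′ → adj H (κ i) (ι j′)) ≡⟨ sym (count-sides (adj H (κ i))) ⟩
    count (adj H (κ i))                                               ≡⟨ degree≡ (κ i) ⟩
    Dα (κ i)                                                          ∎
    where open ≤-Reasoning
  ... | false = ≤-pred (≤-trans (s≤s (≤-reflexive (sym (independent-degree j))))
                               (≤-trans (count-< _ i ji) (clique-degree-≥ i)))

-- P splits the vertices of (β ; γ) ∘ q into those of (β ; γ) and those of q;
-- C splits the former into the clique (degrees β) and the independent set (degrees γ).
module Composition {n na k m l : ℕ} (P : Fin n ↔ (Fin na ⊎ Fin k)) (C : Fin na ↔ (Fin m ⊎ Fin l)) where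
  open Blocks P using (block; first; second; count-blocks) renaming (ι₁ to α; ι₂ to q)
  open Blocks C using () renaming (ι₁ to κ; ι₂ to ι; block to side; first to clique; second to independent;
    count-blocks to count-sides)

  inClique : Fin na → Bool
  inClique u = [ (λ _ → true) , (λ _ → false) ] (Inverse.to C u)

  inClique-κ : ∀ i → inClique (κ i) ≡ true
  inClique-κ i = cong [ (λ _ → true) , (λ _ → false) ] (Inverse.strictlyInverseˡ C (inj₁ i))

  inClique-ι : ∀ j → inClique (ι j) ≡ false
  inClique-ι j = cong [ (λ _ → true) , (λ _ → false) ] (Inverse.strictlyInverseˡ C (inj₂ j))

  count-inClique : count inClique ≡ m
  count-inClique = begin
    count inClique                                ≡⟨ count-sides inClique ⟩
    count (inClique ∘ κ) + count (inClique ∘ ι)  ≡⟨ cong₂ _+_ (count-true _ inClique-κ) (count-false _ inClique-ι) ⟩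
    m + 0                                         ≡⟨ +-identityʳ m ⟩
    m                                             ∎
    where open ≡-Reasoning

  count-three : ∀ (f : Fin n → Bool) → count f ≡ count (f ∘ α ∘ κ) + count (f ∘ α ∘ ι) + count (f ∘ q)
  count-three f = trans (count-blocks f) (cong (_+ count (f ∘ q)) (count-sides (f ∘ α)))

  glued : Mat na → Mat k → Fin na ⊎ Fin k → Fin na ⊎ Fin k → Bool
  glued H′ Q′ (inj₁ u) (inj₁ v) = adj H′ u v
  glued H′ Q′ (inj₁ u) (inj₂ _) = inClique u
  glued H′ Q′ (inj₂ _) (inj₁ v) = inClique v
  glued H′ Q′ (inj₂ y) (inj₂ z) = adj Q′ y z

  glue : Mat na → Mat k → Mat n
  glue H′ Q′ = Mat-tabulate λ x y → glued H′ Q′ (Inverse.to P x) (Inverse.to P y)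

  adj-glue : ∀ H′ Q′ x y → adj (glue H′ Q′) x y ≡ glued H′ Q′ (Inverse.to P x) (Inverse.to P y)
  adj-glue H′ Q′ = adj-tabulate λ x y → glued H′ Q′ (Inverse.to P x) (Inverse.to P y)

  adj-glue-blocks : ∀ H′ Q′ s t → adj (glue H′ Q′) (Inverse.from P s) (Inverse.from P t) ≡ glued H′ Q′ s t
  adj-glue-blocks H′ Q′ s t =
    trans (adj-glue H′ Q′ _ _) (cong₂ (glued H′ Q′) (Inverse.strictlyInverseˡ P s) (Inverse.strictlyInverseˡ P t))

  glued-symmetric : ∀ {H′ Q′} → (∀ u v → adj H′ u v ≡ adj H′ v u) → (∀ y z → adj Q′ y z ≡ adj Q′ z y) →
    ∀ s t → glued H′ Q′ s t ≡ glued H′ Q′ t s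
  glued-symmetric H′-sym Q′-sym (inj₁ u) (inj₁ v) = H′-sym u v
  glued-symmetric H′-sym Q′-sym (inj₁ u) (inj₂ _) = refl
  glued-symmetric H′-sym Q′-sym (inj₂ _) (inj₁ v) = refl
  glued-symmetric H′-sym Q′-sym (inj₂ y) (inj₂ z) = Q′-sym y z

  module _ (D : Fin n → ℕ) (Dα : Fin na → ℕ) (Dq : Fin k → ℕ)
    {H : Mat na} (H-split : IsSplitRealization C Dα H)
    (D-clique : ∀ i → D (α (κ i)) ≡ Dα (κ i) + k)
    (D-independent : ∀ j → D (α (ι j)) ≡ Dα (ι j))
    (D-q : ∀ y → D (q y) ≡ Dq y + m) where

    open SplitRealization H-split

    D-α : ∀ u → D (α u) ≡ Dα u + count {k} (λ _ → inClique u)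
    D-α u with side u
    ... | clique i      = trans (D-clique i) (cong (Dα (κ i) +_) (sym (count-true {k} _ (λ _ → inClique-κ i))))
    ... | independent j = trans (D-independent j) (sym (trans (cong (Dα (ι j) +_) (count-false {k} _ (λ _ → inClique-ι j)))
                                                             (+-identityʳ _)))

    -- Summing the degrees of the clique vertices and comparing with the degree sum of H shows
    -- that each of the three bounds below is attained; this forces the edges between α and q.
    module ForcedEdges {A : Mat n} (A-realizes : Realizes D A) where
      open Realizes A-realizes

      q-degree : Fin na → ℕ
      q-degree u = count λ y → adj A (α u) (q y)

      clique-clique clique-independent : Fin m → ℕ
      clique-clique      i = count λ i′ → adj A (α (κ i)) (α (κ i′))
      clique-independent i = count λ j → adj A (α (κ i)) (α (ι j))

      independent-clique : Fin l → ℕ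
      independent-clique j = count λ i → adj A (α (ι j)) (α (κ i))

      D-α-row : ∀ u →
        D (α u) ≡ count (λ i → adj A (α u) (α (κ i))) + count (λ j → adj A (α u) (α (ι j))) + q-degree u
      D-α-row u = trans (sym (degree≡ (α u))) (count-three (adj A (α u)))

      clique-clique≤ : ∀ i → clique-clique i ≤ count (λ i′ → adj H (κ i) (κ i′))
      clique-clique≤ i = ≤-pred (≤-trans (count-< _ i (loopless (α (κ i)))) (≤-reflexive (sym (clique-degree i))))

      independent-clique≤ : ∀ j → independent-clique j ≤ Dα (ι j)
      independent-clique≤ j = begin
        independent-clique j ≤⟨ m≤m+n _ _ ⟩
        independent-clique j + count (λ j′ → adj A (α (ι j)) (α (ι j′))) ≤⟨ m≤m+n _ _ ⟩
        independent-clique j + count (λ j′ → adj A (α (ι j)) (α (ι j′))) + q-degree (ι j) ≡⟨ sym (D-α-row (ι j)) ⟩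
        D (α (ι j)) ≡⟨ D-independent j ⟩
        Dα (ι j) ∎
        where open ≤-Reasoning

      sum-clique-independent : sum clique-independent ≡ sum independent-clique
      sum-clique-independent = trans (∑-comm (λ i j → bool→ℕ (adj A (α (κ i)) (α (ι j)))))
                                     (sum-cong-≗ λ j → count-cong λ i → symmetric (α (κ i)) (α (ι j)))

      degree-sum : sum clique-clique + sum clique-independent + sum (q-degree ∘ κ)
                 ≡ sum (λ i → count λ i′ → adj H (κ i) (κ i′)) + sum (Dα ∘ ι) + sum {m} (λ _ → k)
      degree-sum = begin
        sum clique-clique + sum clique-independent + sum (q-degree ∘ κ)
          ≡⟨ cong (_+ sum (q-degree ∘ κ)) (sym (∑-distrib-+ clique-clique clique-independent)) ⟩
        sum (λ i → clique-clique i + clique-independent i) + sum (q-degree ∘ κ)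
          ≡⟨ sym (∑-distrib-+ (λ i → clique-clique i + clique-independent i) (q-degree ∘ κ)) ⟩
        sum (λ i → clique-clique i + clique-independent i + q-degree (κ i))
          ≡⟨ sum-cong-≗ (λ i → trans (sym (D-α-row (κ i))) (D-clique i)) ⟩
        sum (λ i → Dα (κ i) + k)
          ≡⟨ ∑-distrib-+ (Dα ∘ κ) (λ _ → k) ⟩
        sum (Dα ∘ κ) + sum {m} (λ _ → k)
          ≡⟨ cong (_+ sum {m} (λ _ → k)) sum-Dα-clique ⟩
        sum (λ i → count λ i′ → adj H (κ i) (κ i′)) + sum (Dα ∘ ι) + sum {m} (λ _ → k) ∎
        where open ≡-Reasoning

      attained : sum clique-independent ≡ sum (Dα ∘ ι) × sum (q-degree ∘ κ) ≡ sum {m} (λ _ → k)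
      attained = +-squeeze (sum-mono-≤ clique-clique≤)
                           (≤-trans (≤-reflexive sum-clique-independent) (sum-mono-≤ independent-clique≤))
                           (sum-mono-≤ (λ i → count≤n (λ y → adj A (α (κ i)) (q y))))
                           degree-sum

      q-degree-clique : ∀ i → q-degree (κ i) ≡ k
      q-degree-clique = sum-mono-≤-≡⇒≗ (λ i → count≤n (λ y → adj A (α (κ i)) (q y))) (proj₂ attained)

      q-degree-independent : ∀ j → q-degree (ι j) ≡ 0
      q-degree-independent j = m+n≡0⇒n≡0 (count λ j′ → adj A (α (ι j)) (α (ι j′)))
        (+-cancelˡ-≡ (independent-clique j) _ 0 (begin
          independent-clique j + (count (λ j′ → adj A (α (ι j)) (α (ι j′))) + q-degree (ι j))
            ≡⟨ sym (+-assoc (independent-clique j) _ _) ⟩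
          independent-clique j + count (λ j′ → adj A (α (ι j)) (α (ι j′))) + q-degree (ι j)
            ≡⟨ sym (D-α-row (ι j)) ⟩
          D (α (ι j))
            ≡⟨ trans (D-independent j) (sym (independent-clique≡ j)) ⟩
          independent-clique j
            ≡⟨ sym (+-identityʳ _) ⟩
          independent-clique j + 0 ∎))
        where
        open ≡-Reasoning
        independent-clique≡ : ∀ j → independent-clique j ≡ Dα (ι j)
        independent-clique≡ = sum-mono-≤-≡⇒≗ independent-clique≤ (trans (sym sum-clique-independent) (proj₁ attained))

      adj-α-q : ∀ u y → adj A (α u) (q y) ≡ inClique u
      adj-α-q u y with side u
      ... | clique i      = trans (count≡n⇒true _ (q-degree-clique i) y) (sym (inClique-κ i))
      ... | independent j = trans (count≡0⇒false _ (q-degree-independent j) y) (sym (inClique-ι j))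

    α-q-agree : ∀ {A A′} → Realizes D A → Realizes D A′ → ∀ u y → adj A (α u) (q y) ≡ adj A′ (α u) (q y)
    α-q-agree A-realizes A′-realizes u y =
      trans (ForcedEdges.adj-α-q A-realizes u y) (sym (ForcedEdges.adj-α-q A′-realizes u y))

    q-α-agree : ∀ {A A′} → Realizes D A → Realizes D A′ → ∀ y u → adj A (q y) (α u) ≡ adj A′ (q y) (α u)
    q-α-agree A-realizes A′-realizes y u =
      trans (Realizes.symmetric A-realizes (q y) (α u))
        (trans (α-q-agree A-realizes A′-realizes u y) (Realizes.symmetric A′-realizes (α u) (q y)))

    restrict-α-realizes : ∀ {A} → Realizes D A → Realizes Dα (restrict α A)
    restrict-α-realizes {A} A-realizes = record
      { loopless  = λ u → trans (adj-restrict α A u u) (loopless (α u))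
      ; symmetric = λ u v → trans (adj-restrict α A u v) (trans (symmetric (α u) (α v)) (sym (adj-restrict α A v u)))
      ; degree≡   = λ u → +-cancelʳ-≡ (count {k} λ _ → inClique u) _ _ (begin
          count (adj (restrict α A) u) + count {k} (λ _ → inClique u)
            ≡⟨ cong₂ _+_ (count-cong (adj-restrict α A u)) (count-cong λ y → sym (ForcedEdges.adj-α-q A-realizes u y)) ⟩
          count (adj A (α u) ∘ α) + count (adj A (α u) ∘ q) ≡⟨ sym (count-blocks (adj A (α u))) ⟩
          count (adj A (α u))                                  ≡⟨ degree≡ (α u) ⟩
          D (α u)                                              ≡⟨ D-α u ⟩
          Dα u + count {k} (λ _ → inClique u)                      ∎) }
      where
      open Realizes A-realizes
      open ≡-Reasoning

    restrict-q-realizes : ∀ {A} → Realizes D A → Realizes Dq (restrict q A)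
    restrict-q-realizes {A} A-realizes = record
      { loopless  = λ y → trans (adj-restrict q A y y) (loopless (q y))
      ; symmetric = λ y z → trans (adj-restrict q A y z) (trans (symmetric (q y) (q z)) (sym (adj-restrict q A z y)))
      ; degree≡   = λ y → +-cancelˡ-≡ m _ _ (begin
          m + count (adj (restrict q A) y)
            ≡⟨ cong₂ _+_ (sym count-inClique) (count-cong (adj-restrict q A y)) ⟩
          count inClique + count (adj A (q y) ∘ q)
            ≡⟨ cong (_+ count (adj A (q y) ∘ q)) (count-cong λ u →
                 sym (trans (symmetric (q y) (α u)) (ForcedEdges.adj-α-q A-realizes u y))) ⟩
          count (adj A (q y) ∘ α) + count (adj A (q y) ∘ q) ≡⟨ sym (count-blocks (adj A (q y))) ⟩
          count (adj A (q y))                                  ≡⟨ degree≡ (q y) ⟩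
          D (q y)                                              ≡⟨ trans (D-q y) (+-comm (Dq y) m) ⟩
          m + Dq y                                             ∎) }
      where
      open Realizes A-realizes
      open ≡-Reasoning

    glue-realizes : ∀ {H′ Q′} → Realizes Dα H′ → Realizes Dq Q′ → Realizes D (glue H′ Q′)
    glue-realizes {H′} {Q′} H′-realizes Q′-realizes = record
      { loopless  = λ x → trans (adj-glue H′ Q′ x x) (glued-loopless (Inverse.to P x))
      ; symmetric = λ x y → trans (adj-glue H′ Q′ x y)
          (trans (glued-symmetric {H′} {Q′} (Realizes.symmetric H′-realizes) (Realizes.symmetric Q′-realizes)
                                  (Inverse.to P x) (Inverse.to P y))
                 (sym (adj-glue H′ Q′ y x)))
      ; degree≡   = λ x → glued-degree (block x) }
      where
      glued-loopless : ∀ s → glued H′ Q′ s s ≡ false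
      glued-loopless (inj₁ u) = Realizes.loopless H′-realizes u
      glued-loopless (inj₂ y) = Realizes.loopless Q′-realizes y
      open ≡-Reasoning
      glued-degree : ∀ {x} → Blocks.Block P x → count (adj (glue H′ Q′) x) ≡ D x
      glued-degree (first u) = begin
        count (adj (glue H′ Q′) (α u))
          ≡⟨ count-blocks (adj (glue H′ Q′) (α u)) ⟩
        count (adj (glue H′ Q′) (α u) ∘ α) + count (adj (glue H′ Q′) (α u) ∘ q)
          ≡⟨ cong₂ _+_ (count-cong (adj-glue-blocks H′ Q′ (inj₁ u) ∘ inj₁))
                       (count-cong (adj-glue-blocks H′ Q′ (inj₁ u) ∘ inj₂)) ⟩
        count (adj H′ u) + count {k} (λ _ → inClique u)
          ≡⟨ cong (_+ count {k} (λ _ → inClique u)) (Realizes.degree≡ H′-realizes u) ⟩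
        Dα u + count {k} (λ _ → inClique u)
          ≡⟨ sym (D-α u) ⟩
        D (α u) ∎
      glued-degree (second y) = begin
        count (adj (glue H′ Q′) (q y))
          ≡⟨ count-blocks (adj (glue H′ Q′) (q y)) ⟩
        count (adj (glue H′ Q′) (q y) ∘ α) + count (adj (glue H′ Q′) (q y) ∘ q)
          ≡⟨ cong₂ _+_ (count-cong (adj-glue-blocks H′ Q′ (inj₂ y) ∘ inj₁))
                       (count-cong (adj-glue-blocks H′ Q′ (inj₂ y) ∘ inj₂)) ⟩
        count inClique + count (adj Q′ y)
          ≡⟨ cong₂ _+_ count-inClique (Realizes.degree≡ Q′-realizes y) ⟩
        m + Dq y
          ≡⟨ trans (+-comm m (Dq y)) (sym (D-q y)) ⟩
        D (q y) ∎

    restrict-α-glue : ∀ H′ Q′ → restrict α (glue H′ Q′) ≡ H′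
    restrict-α-glue H′ Q′ = Mat-ext λ u v →
      trans (adj-restrict α (glue H′ Q′) u v) (adj-glue-blocks H′ Q′ (inj₁ u) (inj₁ v))

    restrict-q-glue : ∀ H′ Q′ → restrict q (glue H′ Q′) ≡ Q′
    restrict-q-glue H′ Q′ = Mat-ext λ y z →
      trans (adj-restrict q (glue H′ Q′) y z) (adj-glue-blocks H′ Q′ (inj₂ y) (inj₂ z))

    glue-restrict : ∀ {A} → Realizes D A → glue (restrict α A) (restrict q A) ≡ A
    glue-restrict {A} A-realizes = Mat-ext λ x y → glued-restrict (block x) (block y)
      where
      A′ = glue (restrict α A) (restrict q A)
      glued-restrict : ∀ {x y} → Blocks.Block P x → Blocks.Block P y → adj A′ x y ≡ adj A x y
      glued-restrict (first u) (first v) =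
        trans (adj-glue-blocks _ _ (inj₁ u) (inj₁ v)) (adj-restrict α A u v)
      glued-restrict (first u) (second y) =
        trans (adj-glue-blocks _ _ (inj₁ u) (inj₂ y)) (sym (ForcedEdges.adj-α-q A-realizes u y))
      glued-restrict (second y) (first u) =
        trans (adj-glue-blocks _ _ (inj₂ y) (inj₁ u))
          (sym (trans (Realizes.symmetric A-realizes (q y) (α u)) (ForcedEdges.adj-α-q A-realizes u y)))
      glued-restrict (second y) (second z) =
        trans (adj-glue-blocks _ _ (inj₂ y) (inj₂ z)) (adj-restrict q A y z)

    composition-≅ : RealizationGraph n D ≅ (RealizationGraph na Dα □ RealizationGraph k Dq)
    composition-≅ = record
      { bij = mk↔ₛ′ split merge
          (λ (r , s) → cong₂ _,_ (realization-≡ (restrict-α-glue (proj₁ r) (proj₁ s)))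
                                 (realization-≡ (restrict-q-glue (proj₁ r) (proj₁ s))))
          (λ r → realization-≡ (glue-restrict (realizes r)))
      ; preserves = λ r r′ → mk⇔ (to r r′) (from r r′) }
      where
      split : Realizations n D → Realizations na Dα × Realizations k Dq
      split r = realization (restrict-α-realizes (realizes r)) , realization (restrict-q-realizes (realizes r))

      merge : Realizations na Dα × Realizations k Dq → Realizations n D
      merge (r , s) = realization (glue-realizes (realizes r) (realizes s))

      switch-blocks : ∀ r r′ → TwoSwitch (proj₁ r) (proj₁ r′) ⇔ SwitchedInOneBlock P (proj₁ r) (proj₁ r′)
      switch-blocks r r′ = TwoSwitch-blocks P {proj₁ r} {proj₁ r′}
        (α-q-agree (realizes r) (realizes r′)) (q-α-agree (realizes r) (realizes r′))

      to : ∀ r r′ → Adj (RealizationGraph n D) r r′ →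
        Adj (RealizationGraph na Dα □ RealizationGraph k Dq) (split r) (split r′)
      to r r′ (inj₁ sw) with Equivalence.to (switch-blocks r r′) sw
      ... | inj₁ (s , e) = inj₂ (inj₁ s , realization-≡ e)
      ... | inj₂ (e , s) = inj₁ (realization-≡ e , inj₁ s)
      to r r′ (inj₂ sw) with Equivalence.to (switch-blocks r′ r) sw
      ... | inj₁ (s , e) = inj₂ (inj₂ s , realization-≡ (sym e))
      ... | inj₂ (e , s) = inj₁ (realization-≡ (sym e) , inj₂ s)

      from : ∀ r r′ → Adj (RealizationGraph na Dα □ RealizationGraph k Dq) (split r) (split r′) →
        Adj (RealizationGraph n D) r r′
      from r r′ (inj₁ (e , inj₁ s)) = inj₁ (Equivalence.from (switch-blocks r r′) (inj₂ (cong proj₁ e , s)))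
      from r r′ (inj₁ (e , inj₂ s)) = inj₂ (Equivalence.from (switch-blocks r′ r) (inj₂ (sym (cong proj₁ e) , s)))
      from r r′ (inj₂ (inj₁ s , e)) = inj₁ (Equivalence.from (switch-blocks r r′) (inj₁ (s , cong proj₁ e)))
      from r r′ (inj₂ (inj₂ s , e)) = inj₂ (Equivalence.from (switch-blocks r′ r) (inj₁ (s , sym (cong proj₁ e))))

module _ {X : Set} {ys : List X} where
  index-++ˡ : ∀ xs → Fin (length xs) → Fin (length (xs ++ ys))
  index-++ˡ (x ∷ xs) zero    = zero
  index-++ˡ (x ∷ xs) (suc i) = suc (index-++ˡ xs i)

  index-++ʳ : ∀ xs → Fin (length ys) → Fin (length (xs ++ ys))
  index-++ʳ []       j = j
  index-++ʳ (x ∷ xs) j = suc (index-++ʳ xs j)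

  index-++⁻¹ : ∀ xs → Fin (length (xs ++ ys)) → Fin (length xs) ⊎ Fin (length ys)
  index-++⁻¹ []       j       = inj₂ j
  index-++⁻¹ (x ∷ xs) zero    = inj₁ zero
  index-++⁻¹ (x ∷ xs) (suc p) = Sum.map₁ suc (index-++⁻¹ xs p)

  ++-↔ : ∀ xs → Fin (length (xs ++ ys)) ↔ (Fin (length xs) ⊎ Fin (length ys))
  ++-↔ xs = mk↔ₛ′ (index-++⁻¹ xs) [ index-++ˡ xs , index-++ʳ xs ] (inverseˡ xs) (inverseʳ xs)
    where
    inverseˡ : ∀ xs s → index-++⁻¹ xs ([ index-++ˡ xs , index-++ʳ xs ] s) ≡ s
    inverseˡ []       (inj₂ j)       = refl
    inverseˡ (x ∷ xs) (inj₁ zero)    = refl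
    inverseˡ (x ∷ xs) (inj₁ (suc i)) = cong (Sum.map₁ suc) (inverseˡ xs (inj₁ i))
    inverseˡ (x ∷ xs) (inj₂ j)       = cong (Sum.map₁ suc) (inverseˡ xs (inj₂ j))
    inverseʳ : ∀ xs p → [ index-++ˡ xs , index-++ʳ xs ] (index-++⁻¹ xs p) ≡ p
    inverseʳ []       p       = refl
    inverseʳ (x ∷ xs) zero    = refl
    inverseʳ (x ∷ xs) (suc p) with index-++⁻¹ xs p | inverseʳ xs p
    ... | inj₁ i | e = cong suc e
    ... | inj₂ j | e = cong suc e

  lookup-index-++ˡ : ∀ xs i → List.lookup (xs ++ ys) (index-++ˡ xs i) ≡ List.lookup xs i
  lookup-index-++ˡ (x ∷ xs) zero    = refl
  lookup-index-++ˡ (x ∷ xs) (suc i) = lookup-index-++ˡ xs i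

  lookup-index-++ʳ : ∀ xs j → List.lookup (xs ++ ys) (index-++ʳ xs j) ≡ List.lookup ys j
  lookup-index-++ʳ []       j = refl
  lookup-index-++ʳ (x ∷ xs) j = lookup-index-++ʳ xs j

  toℕ-index-++ˡ : ∀ xs i → toℕ (index-++ˡ xs i) ≡ toℕ i
  toℕ-index-++ˡ (x ∷ xs) zero    = refl
  toℕ-index-++ˡ (x ∷ xs) (suc i) = cong suc (toℕ-index-++ˡ xs i)

  toℕ-index-++ʳ : ∀ xs j → toℕ (index-++ʳ xs j) ≡ length xs + toℕ j
  toℕ-index-++ʳ []       j = refl
  toℕ-index-++ʳ (x ∷ xs) j = cong suc (toℕ-index-++ʳ xs j)

module _ {X Y : Set} (f : X → Y) where
  index-map : ∀ xs → Fin (length xs) → Fin (length (map f xs))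
  index-map (x ∷ xs) zero    = zero
  index-map (x ∷ xs) (suc i) = suc (index-map xs i)

  index-map⁻¹ : ∀ xs → Fin (length (map f xs)) → Fin (length xs)
  index-map⁻¹ (x ∷ xs) zero    = zero
  index-map⁻¹ (x ∷ xs) (suc i) = suc (index-map⁻¹ xs i)

  map-↔ : ∀ xs → Fin (length (map f xs)) ↔ Fin (length xs)
  map-↔ xs = mk↔ₛ′ (index-map⁻¹ xs) (index-map xs) (inverseˡ xs) (inverseʳ xs)
    where
    inverseˡ : ∀ xs i → index-map⁻¹ xs (index-map xs i) ≡ i
    inverseˡ (x ∷ xs) zero    = refl
    inverseˡ (x ∷ xs) (suc i) = cong suc (inverseˡ xs i)
    inverseʳ : ∀ xs i → index-map xs (index-map⁻¹ xs i) ≡ i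
    inverseʳ (x ∷ xs) zero    = refl
    inverseʳ (x ∷ xs) (suc i) = cong suc (inverseʳ xs i)

  lookup-index-map : ∀ xs i → List.lookup (map f xs) (index-map xs i) ≡ f (List.lookup xs i)
  lookup-index-map (x ∷ xs) zero    = refl
  lookup-index-map (x ∷ xs) (suc i) = lookup-index-map xs i

insertD-↭ : ∀ x ys → insertD x ys ↭ x ∷ ys
insertD-↭ x []       = ↭-refl
insertD-↭ x (y ∷ ys) with y ≤ᵇ x
... | true  = ↭-refl
... | false = ↭-trans (↭-prep y (insertD-↭ x ys)) (↭-swap y x ↭-refl)

sortD-↭ : ∀ xs → sortD xs ↭ xs
sortD-↭ []       = ↭-refl
sortD-↭ (x ∷ xs) = ↭-trans (insertD-↭ x (sortD xs)) (↭-prep x (sortD-↭ xs))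

insertD-descending : ∀ x {ys} → AllPairs _≥_ ys → AllPairs _≥_ (insertD x ys)
insertD-descending x {[]}     _ = [] ∷ []
insertD-descending x {y ∷ ys} (y≥ys ∷ ys↘) with y ≤ᵇ x in y≤ᵇx
... | true  = (x≥y ∷ All.map (≤-trans′ x≥y) y≥ys) ∷ y≥ys ∷ ys↘
  where
  x≥y = ≤ᵇ⇒≤ y x (subst T (sym y≤ᵇx) tt)
  ≤-trans′ : ∀ {z} → x ≥ y → y ≥ z → x ≥ z
  ≤-trans′ x≥y y≥z = ≤-trans y≥z x≥y
... | false = All-resp-↭ (↭-sym (insertD-↭ x ys)) (y≥x ∷ y≥ys) ∷ insertD-descending x ys↘
  where
  y≥x : y ≥ x
  y≥x = ≰⇒≥ (λ y≤x → subst T y≤ᵇx (≤⇒≤ᵇ y≤x))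

sortD-descending : ∀ xs → AllPairs _≥_ (sortD xs)
sortD-descending []       = []
sortD-descending (x ∷ xs) = insertD-descending x (sortD-descending xs)

descending-↭⇒≡ : ∀ {xs ys} → AllPairs _≥_ xs → AllPairs _≥_ ys → xs ↭ ys → xs ≡ ys
descending-↭⇒≡ xs↘ ys↘ xs↭ys = Pointwise-≡⇒≡
  (↗↭↗⇒≋ (Flip.totalOrder ≤-totalOrder) (AllPairs⇒Linked xs↘) (AllPairs⇒Linked ys↘) (↭⇒↭ₛ xs↭ys))

sortD-≡ : ∀ {xs ys} → AllPairs _≥_ ys → xs ↭ ys → sortD xs ≡ ys
sortD-≡ {xs} ys↘ xs↭ys = descending-↭⇒≡ (sortD-descending xs) ys↘ (↭-trans (sortD-↭ xs) xs↭ys)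

Descending⇒AllPairs : ∀ {xs} → Descending xs → AllPairs _≥_ xs
Descending⇒AllPairs = Linked⇒AllPairs (λ x≥y y≥z → ≤-trans y≥z x≥y)

All-lookup⁺ : ∀ {P : ℕ → Set} (xs : List ℕ) → (∀ i → P (List.lookup xs i)) → All P xs
All-lookup⁺ []       Pxs = []
All-lookup⁺ (x ∷ xs) Pxs = Pxs zero ∷ All-lookup⁺ xs (Pxs ∘ suc)

All-lookup⁻ : ∀ {P : ℕ → Set} {xs : List ℕ} → All P xs → ∀ i → P (List.lookup xs i)
All-lookup⁻ (px ∷ pxs) zero    = px
All-lookup⁻ (px ∷ pxs) (suc i) = All-lookup⁻ pxs i

⊎-shuffle : ∀ {A B C : Set} → (A ⊎ (B ⊎ C)) ↔ ((A ⊎ C) ⊎ B)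
⊎-shuffle = mk↔ₛ′
  [ inj₁ ∘ inj₁ , [ inj₂ , inj₁ ∘ inj₂ ] ]
  [ [ inj₁ , inj₂ ∘ inj₂ ] , inj₂ ∘ inj₁ ]
  (λ { (inj₁ (inj₁ _)) → refl ; (inj₁ (inj₂ _)) → refl ; (inj₂ _) → refl })
  (λ { (inj₁ _) → refl ; (inj₂ (inj₁ _)) → refl ; (inj₂ (inj₂ _)) → refl })

module _ {β γ : List ℕ} {H : Mat (length (β ++ γ))} (t : T (isSplitRealization β γ H)) where
  private
    inβ : Fin (length (β ++ γ)) → Bool
    inβ i = suc (toℕ i) ≤ᵇ length β

    entry : ∀ i j → T (if i ==F j then true
                       else if inβ i ∧ inβ j then adj H i j
                       else if not (inβ i) ∧ not (inβ j) then not (adj H i j)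
                       else true)
    entry i j = Equivalence.to (T-allF⇔ _) (Equivalence.to (T-allF⇔ _) (proj₂ (Equivalence.to T-∧ t)) i) j

    inβ-++ˡ : ∀ i → inβ (index-++ˡ β i) ≡ true
    inβ-++ˡ i = Equivalence.to T-≡ (≤⇒≤ᵇ (subst (λ x → suc x ≤ length β) (sym (toℕ-index-++ˡ β i)) (Fin.toℕ<n i)))

    inβ-++ʳ : ∀ j → inβ (index-++ʳ β j) ≡ false
    inβ-++ʳ j with inβ (index-++ʳ β j) in eq
    ... | true  = ⊥-elim (<⇒≱ (≤ᵇ⇒≤ _ _ (Equivalence.from T-≡ eq))
                              (subst (length β ≤_) (sym (toℕ-index-++ʳ β j)) (m≤m+n _ _)))
    ... | false = refl

    open Blocks (++-↔ {ys = γ} β) using (ι₁-injective; ι₂-injective)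

    H-realizes : Realizes (List.lookup (β ++ γ)) H
    H-realizes = Equivalence.to (T-isRealizationOf⇔ _ H) (proj₁ (Equivalence.to T-∧ t))

    clique : ∀ i i′ → ¬ i ≡ i′ → adj H (index-++ˡ β i) (index-++ˡ β i′) ≡ true
    clique i i′ i≢i′ with entry (index-++ˡ β i) (index-++ˡ β i′)
    ... | e rewrite ==F-≢ (i≢i′ ∘ ι₁-injective) | inβ-++ˡ i | inβ-++ˡ i′ = Equivalence.to T-≡ e

    independent : ∀ j j′ → adj H (index-++ʳ β j) (index-++ʳ β j′) ≡ false
    independent j j′ with j Fin.≟ j′
    ... | yes refl = Realizes.loopless H-realizes (index-++ʳ β j)
    ... | no j≢j′ with entry (index-++ʳ β j) (index-++ʳ β j′)
    ... | e rewrite ==F-≢ (j≢j′ ∘ ι₂-injective) | inβ-++ʳ j | inβ-++ʳ j′ = Equivalence.to T-not-≡ e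

  T-isSplitRealization⇒ : IsSplitRealization (++-↔ β) (List.lookup (β ++ γ)) H
  T-isSplitRealization⇒ = record { realizes-Dα = H-realizes ; clique = clique ; independent = independent }

module ComposeLists {β γ q : List ℕ} (α-split : IsSplitted (β , γ)) (q-degrees : IsDegreeSequence q) where
  m k : ℕ
  m = length β
  k = length q

  top middle composed : List ℕ
  top      = map (_+ k) β
  middle   = map (_+ m) q
  composed = top ++ (middle ++ γ)

  layout : Fin (length composed) ↔ (Fin (length (β ++ γ)) ⊎ Fin k)
  layout = ↔-trans (++-↔ top)
          (↔-trans (map-↔ (_+ k) β ⊎-↔ ↔-trans (++-↔ middle) (map-↔ (_+ m) q ⊎-↔ ↔-refl))
          (↔-trans ⊎-shuffle (↔-sym (++-↔ β) ⊎-↔ ↔-refl)))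

  -- Inverse.from layout first applies Inverse.to (++-↔ β), which cancels only propositionally.
  D-clique : ∀ i → List.lookup composed (Inverse.from layout (inj₁ (index-++ˡ β i)))
                 ≡ List.lookup (β ++ γ) (index-++ˡ β i) + k
  D-clique i rewrite Inverse.strictlyInverseˡ (++-↔ {ys = γ} β) (inj₁ i) =
    trans (lookup-index-++ˡ top (index-map (_+ k) β i))
          (trans (lookup-index-map (_+ k) β i) (cong (_+ k) (sym (lookup-index-++ˡ {ys = γ} β i))))

  D-independent : ∀ j → List.lookup composed (Inverse.from layout (inj₁ (index-++ʳ β j)))
                      ≡ List.lookup (β ++ γ) (index-++ʳ β j)
  D-independent j rewrite Inverse.strictlyInverseˡ (++-↔ {ys = γ} β) (inj₂ j) =
    trans (lookup-index-++ʳ top (index-++ʳ middle j))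
          (trans (lookup-index-++ʳ middle j) (sym (lookup-index-++ʳ {ys = γ} β j)))

  D-q : ∀ y → List.lookup composed (Inverse.from layout (inj₂ y)) ≡ List.lookup q y + m
  D-q y = trans (lookup-index-++ʳ top (index-++ˡ middle (index-map (_+ m) q y)))
                (trans (lookup-index-++ˡ middle (index-map (_+ m) q y)) (lookup-index-map (_+ m) q y))

  H : Mat (length (β ++ γ))
  H = proj₁ (proj₂ (proj₂ α-split))

  H-split-realization : T (isSplitRealization β γ H)
  H-split-realization = proj₂ (proj₂ (proj₂ α-split))

  H-split : IsSplitRealization (++-↔ β) (List.lookup (β ++ γ)) H
  H-split = T-isSplitRealization⇒ H-split-realization

  open SplitRealization H-split

  composed-≅ : RG composed ≅ (RG (β ++ γ) □ RG q)
  composed-≅ = Composition.composition-≅ layout (++-↔ β)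
    (List.lookup composed) (List.lookup (β ++ γ)) (List.lookup q) H-split D-clique D-independent D-q

  β-≥ : ∀ i → m ≤ suc (List.lookup β i)
  β-≥ i = subst (λ x → m ≤ suc x) (lookup-index-++ˡ {ys = γ} β i) (clique-degree-≥ i)

  γ-≤ : ∀ j → List.lookup γ j ≤ m
  γ-≤ j = subst (_≤ m) (lookup-index-++ʳ {ys = γ} β j) (independent-degree-≤ j)

  γ≤β : ∀ i j → List.lookup γ j ≤ List.lookup β i
  γ≤β i j = subst₂ _≤_ (lookup-index-++ʳ {ys = γ} β j) (lookup-index-++ˡ {ys = γ} β i) (independent≤clique i j)

  q-< : ∀ y → List.lookup q y < k
  q-< = Realizes⇒degree< (realizes (proj₂ q-degrees))

  β↘ : AllPairs _≥_ β
  β↘ = Descending⇒AllPairs (proj₁ α-split)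

  γ↘ : AllPairs _≥_ γ
  γ↘ = Descending⇒AllPairs (proj₁ (proj₂ α-split))

  q↘ : AllPairs _≥_ q
  q↘ = Descending⇒AllPairs (proj₁ q-degrees)

  composed-descending : AllPairs _≥_ composed
  composed-descending = AllPairs.++⁺
    (AllPairs.map⁺ (AllPairs.map (+-monoˡ-≤ k) β↘))
    (AllPairs.++⁺ (AllPairs.map⁺ (AllPairs.map (+-monoˡ-≤ m) q↘)) γ↘
      (All.map⁺ (All-lookup⁺ q λ y → All-lookup⁺ γ λ j → ≤-trans (γ-≤ j) (m≤n+m m _))))
    (All.map⁺ (All-lookup⁺ β λ i → All.++⁺
      (All.map⁺ (All-lookup⁺ q λ y → top≥middle i y))
      (All-lookup⁺ γ λ j → ≤-trans (γ≤β i j) (m≤m+n _ k))))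
    where
    -- q y + m ≤ (k - 1) + (1 + β i)
    top≥middle : ∀ i y → List.lookup q y + m ≤ List.lookup β i + k
    top≥middle i y = ≤-pred (begin
      suc (List.lookup q y + m)      ≤⟨ +-mono-≤ (q-< y) (β-≥ i) ⟩
      k + suc (List.lookup β i)      ≡⟨ +-suc k _ ⟩
      suc (k + List.lookup β i)      ≡⟨ cong suc (+-comm k _) ⟩
      suc (List.lookup β i + k)      ∎)
      where open ≤-Reasoning

  composed-≡ : (β , γ) ∘ds q ≡ composed
  composed-≡ = sortD-≡ composed-descending (++⁺ˡ top (++-comm γ middle))

  sseq-≡ : sseq (β , γ) ≡ β ++ γ
  sseq-≡ = sortD-≡ (AllPairs.++⁺ β↘ γ↘ (All-lookup⁺ β λ i → All-lookup⁺ γ λ j → γ≤β i j)) ↭-refl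

  composed-realization : Realization composed
  composed-realization =
    ≅-from composed-≅ ((H , proj₁ (Equivalence.to T-∧ H-split-realization)) , proj₂ q-degrees)

∘ds-≅ : ∀ {β γ q} → IsSplitted (β , γ) → IsDegreeSequence q →
  IsDegreeSequence ((β , γ) ∘ds q) × (RG ((β , γ) ∘ds q) ≅ (RG (sseq (β , γ)) □ RG q))
∘ds-≅ α-split q-degrees
  rewrite ComposeLists.composed-≡ α-split q-degrees | ComposeLists.sseq-≡ α-split q-degrees =
  (AllPairs⇒Linked composed-descending , composed-realization) , composed-≅
  where open ComposeLists α-split q-degrees

foldr-∘ds-≅ : ∀ αs {d₀} → All IsSplitted αs → IsDegreeSequence d₀ →
  IsDegreeSequence (foldr _∘ds_ d₀ αs) × (RG (foldr _∘ds_ d₀ αs) ≅ productRG αs d₀)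
foldr-∘ds-≅ []              []                     d₀-degrees = d₀-degrees , ≅-refl
foldr-∘ds-≅ ((β , γ) ∷ αs) (α-split ∷ αs-split) d₀-degrees =
  let (d-degrees , d-≅)    = foldr-∘ds-≅ αs αs-split d₀-degrees
      (αd-degrees , αd-≅) = ∘ds-≅ α-split d-degrees
  in αd-degrees , ≅-trans αd-≅ (□-cong ≅-refl d-≅)

theorem3p4 : (d : List ℕ) (αs : List Splitted) (d₀ : List ℕ) →
  IsDegreeSequence d → IsCanonicalDecomposition d αs d₀ →
  RG d ≅ productRG αs d₀
theorem3p4 d αs d₀ _ (αs-split , d₀-degrees , _ , _ , refl) =
  proj₂ (foldr-∘ds-≅ αs (All.map proj₁ αs-split) d₀-degrees)
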